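{- Let $\mathrm{OPT}$ be a minimum vertex cover of the current graph and $M$ the matching maintained by the Duo-Halve algorithm, with $V_M$ its saturated vertices. If $\mathrm{OPT}\setminus V_M\ne\emptyset$, or there exists an edge $(u,v)\in M$ with $\{u,v\}\subseteq\mathrm{OPT}$, then $\frac{|\mathrm{DH}|}{|\mathrm{OPT}|}\le 2-\frac{2}{|\mathrm{OPT}|}$, where $\mathrm{DH}$ is the vertex cover maintained by Duo-Halve.
   Context: Online vertex cover (vertex-arrival): vertices of an unknown graph arrive one at a time with their edges to previously revealed vertices; the algorithm maintains a set of accepted vertices covering all revealed edges, and may late-accept or late-reject vertices. Duo-Halve algorithm: it maintains a matching $M$ built incrementally (edges never removed); $V_M$ denotes the saturated vertices; vertices outside $V_M$ are always rejected. $e_1,e_2$ denote the most recently and second most recently added matching edges; a matching edge is full if both endpoints are accepted, half otherwise. When a new vertex $v$ arrives: if $v$ has a neighbor $p\notin V_M$ (chosen arbitrarily), $(p,v)$ is added to $M$, the old $e_1$ becomes $e_2$ and $(p,v)$ becomes $e_1$. Then every rejected vertex of $V_M$ adjacent to $v$ not an endpoint of $e_1,e_2$ is late-accepted, and HalveBoth chooses statuses of the endpoints of $e_1,e_2$ among those yielding a valid vertex cover, minimizing the number of accepted endpoints of $e_1,e_2$, with ties broken in favour of accepting fewer endpoints of $e_1$ and then fewer late operations. -}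

module Defs where

open import Data.Nat using (ℕ; zero; suc; _+_; _*_; _≤_; _<_; _≡ᵇ_)
open import Data.Bool using (Bool; true; false; _∧_; _∨_; not; if_then_else_; _xor_)
open import Data.List using (List; []; _∷_; length; map; upTo; concatMap; take)
open import Data.Nat.ListAction using (sum)
open import Data.Bool.ListAction using (any)
open import Data.List.Membership.Propositional using (_∈_)
open import Data.List.Relation.Unary.All using (All)
open import Data.Product using (_×_; _,_; proj₁; proj₂)
open import Data.Sum using (_⊎_)
open import Relation.Binary.PropositionalEquality using (_≡_)

-- A graph is the list of arrivals, MOST RECENT FIRST: the entry for
-- vertex k (k = number of earlier arrivals) is the list of its
-- neighbours among the earlier vertices 0 … k-1.
-- Vertices of a graph G are 0 … length G - 1.

Graph : Set
Graph = List (List ℕ)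

-- Arc G u v : u is an earlier neighbour of v (so {u,v} is an edge).
data Arc : Graph → ℕ → ℕ → Set where
  here  : ∀ {G ns u} → u ∈ ns → Arc (ns ∷ G) u (length G)
  there : ∀ {G ns u v} → Arc G u v → Arc (ns ∷ G) u v

VSet : Set
VSet = ℕ → Bool

Cover : Graph → VSet → Set
Cover G S = ∀ u v → Arc G u v → S u ≡ true ⊎ S v ≡ true

cnt : VSet → List ℕ → ℕ
cnt S xs = sum (map (λ w → if S w then 1 else 0) xs)

size : Graph → VSet → ℕ
size G S = cnt S (upTo (length G))

MinCover : Graph → VSet → Set
MinCover G S = Cover G S × (∀ S′ → Cover G S′ → size G S ≤ size G S′)

-- Matchings: list of edges, MOST RECENTLY ADDED FIRST
-- (so e₁ is the head and e₂ the second element).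

Matching : Set
Matching = List (ℕ × ℕ)

memb : ℕ → List ℕ → Bool
memb w xs = any (w ≡ᵇ_) xs

endpoints : Matching → List ℕ
endpoints M = concatMap (λ e → proj₁ e ∷ proj₂ e ∷ []) M

inVM : Matching → ℕ → Bool
inVM M w = memb w (endpoints M)

top2 : Matching → List ℕ
top2 M = endpoints (take 2 M)

top1 : Matching → List ℕ
top1 M = endpoints (take 1 M)

record State : Set where
  constructor ⟨_,_⟩
  field
    matching : Matching
    accepted : VSet
open State public

initial : State
initial = ⟨ [] , (λ _ → false) ⟩

data MatchUpd (M : Matching) (ns : List ℕ) (v : ℕ) : Matching → Set where
  addEdge : ∀ {p} → p ∈ ns → inVM M p ≡ false → MatchUpd M ns v ((p , v) ∷ M)
  noEdge  : (∀ p → p ∈ ns → inVM M p ≡ true) → MatchUpd M ns v M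

lateAccept : Matching → List ℕ → VSet → VSet
lateAccept M′ ns acc w = (inVM M′ w ∧ memb w ns ∧ not (memb w (top2 M′))) ∨ acc w

Admissible : Graph → Matching → VSet → VSet → Set
Admissible G′ M′ acc₁ f =
  Cover G′ f × (∀ w → memb w (top2 M′) ≡ false → f w ≡ acc₁ w)

-- number of late operations among endpoints of e₁,e₂ (the new vertex v
-- itself is not late; previous statuses are acc)
lateOps : Matching → ℕ → VSet → VSet → ℕ
lateOps M′ v acc f =
  sum (map (λ w → if (w ≡ᵇ v) then 0 else (if f w xor acc w then 1 else 0)) (top2 M′))

LexLeq : ℕ × ℕ × ℕ → ℕ × ℕ × ℕ → Set
LexLeq (a , b , c) (a′ , b′ , c′) =
  a < a′ ⊎ (a ≡ a′ × (b < b′ ⊎ (b ≡ b′ × c ≤ c′)))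

cost : Matching → ℕ → VSet → VSet → ℕ × ℕ × ℕ
cost M′ v acc f = cnt f (top2 M′) , cnt f (top1 M′) , lateOps M′ v acc f

-- One step of Duo-Halve: vertex v = length G arrives with neighbour list ns,
-- G′ = ns ∷ G.  Remaining ties are broken arbitrarily (any optimal choice).
record Step (G : Graph) (ns : List ℕ) (s s′ : State) : Set where
  field
    matchUpd : MatchUpd (matching s) ns (length G) (matching s′)
    admissible : Admissible (ns ∷ G) (matching s′)
                   (lateAccept (matching s′) ns (accepted s)) (accepted s′)
    optimal : ∀ f → Admissible (ns ∷ G) (matching s′)
                      (lateAccept (matching s′) ns (accepted s)) f →
              LexLeq (cost (matching s′) (length G) (accepted s) (accepted s′))
                     (cost (matching s′) (length G) (accepted s) f)

data Reachable : Graph → State → Set where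
  start : Reachable [] initial
  step  : ∀ {G ns s s′} → Reachable G s → All (_< length G) ns →
          Step G ns s s′ → Reachable (ns ∷ G) s′

-- Duo-Halve only ever accepts saturated vertices, so |DH| ≤ |V_M| = 2|M|.
-- Conversely, the edges of M are disjoint edges of the graph, so any vertex
-- cover contains at least |M| distinct vertices of V_M, one per edge; either
-- hypothesis supplies one more (a vertex of OPT outside V_M, or a second
-- endpoint of some matching edge), whence |OPT| ≥ |M| + 1 and
-- |DH| + 2 ≤ 2|M| + 2 ≤ 2|OPT|.
module Submission where

open import Defs
open import Data.Nat using (ℕ; _+_; _*_; _≤_; _<_)
open import Data.Bool using (true; false)
open import Data.List using (length)
open import Data.List.Relation.Unary.Any using (Any)
open import Data.Product using (Σ; ∃; _×_; _,_; proj₁; proj₂)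
open import Data.Sum using (_⊎_)
open import Relation.Binary.PropositionalEquality using (_≡_)

open import Data.Nat using (suc; z≤n; s≤s; _≡ᵇ_)
open import Data.Nat.Properties
open import Data.Bool using (Bool; if_then_else_)
open import Data.Bool.Properties using (T-≡) renaming (_≟_ to _≟ᵇ_)
open import Data.List using (List; []; _∷_; _++_; [_]; filter; upTo; take)
open import Data.List.Relation.Unary.Any using (here; there)
import Data.List.Relation.Unary.Any as Any
open import Data.List.Relation.Unary.Any.Properties using (any⁺; any⁻)
open import Data.List.Relation.Unary.All using (All; []; _∷_)
import Data.List.Relation.Unary.All as All
open import Data.List.Relation.Unary.All.Properties using (¬Any⇒All¬)
open import Data.List.Relation.Unary.AllPairs using ([]; _∷_)
open import Data.List.Relation.Unary.Unique.Propositional using (Unique)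
import Data.List.Relation.Unary.Unique.Propositional.Properties as Unique
open import Data.List.Membership.Propositional using (_∈_; _∉_)
open import Data.List.Membership.Propositional.Properties
  using (∈-∃++; ∈-filter⁺; ∈-filter⁻; ∈-upTo⁺)
open import Data.List.Relation.Binary.Subset.Propositional using (_⊆_)
open import Data.List.Relation.Binary.Permutation.Propositional.Properties
  using (shift; ∈-resp-↭; ↭-length)
open import Data.Sum using (inj₁; inj₂; [_,_]′)
open import Function.Bundles using (Equivalence)
open import Relation.Binary.PropositionalEquality using (refl; sym; trans; cong; module ≡-Reasoning)
open import Function using (_∘′_)
open import Relation.Nullary using (¬_; contradiction)

unique-⊆⇒length≤ : ∀ {xs ys : List ℕ} → Unique ys → ys ⊆ xs → length ys ≤ length xs
unique-⊆⇒length≤ {ys = []} _ _ = z≤n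
unique-⊆⇒length≤ {xs} {y ∷ ys} (y∉ys ∷ unique) ys⊆xs
  with as , bs , refl ← ∈-∃++ (ys⊆xs (here refl)) = begin
    suc (length ys)            ≤⟨ s≤s (unique-⊆⇒length≤ unique ys⊆as++bs) ⟩
    suc (length (as ++ bs))    ≡⟨ ↭-length (shift y as bs) ⟨
    length (as ++ [ y ] ++ bs) ∎
  where
  open ≤-Reasoning
  ys⊆as++bs : ys ⊆ as ++ bs
  ys⊆as++bs {z} z∈ys with ∈-resp-↭ (shift y as bs) (ys⊆xs (there z∈ys))
  ... | here refl = contradiction refl (All.lookup y∉ys z∈ys)
  ... | there z∈as++bs = z∈as++bs

χ : Bool → ℕ
χ b = if b then 1 else 0

cnt≡length-filter : ∀ (S : VSet) xs → cnt S xs ≡ length (filter (λ w → S w ≟ᵇ true) xs)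
cnt≡length-filter S [] = refl
cnt≡length-filter S (x ∷ xs) with S x
... | true  = cong suc (cnt≡length-filter S xs)
... | false = cnt≡length-filter S xs

cnt≤length : ∀ (S : VSet) {xs ys} → Unique xs → (∀ {w} → w ∈ xs → S w ≡ true → w ∈ ys) →
             cnt S xs ≤ length ys
cnt≤length S {xs} unique S∩xs⊆ys rewrite cnt≡length-filter S xs =
  unique-⊆⇒length≤ (Unique.filter⁺ _ unique)
    (λ w∈ → let w∈xs , Sw = ∈-filter⁻ (λ w → S w ≟ᵇ true) w∈ in S∩xs⊆ys w∈xs Sw)

cnt-mono-⊆ : ∀ (S : VSet) {xs ys} → Unique ys → ys ⊆ xs → cnt S ys ≤ cnt S xs
cnt-mono-⊆ S {xs} {ys} unique ys⊆xs rewrite cnt≡length-filter S xs =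
  cnt≤length S unique (λ w∈ys Sw → ∈-filter⁺ (λ w → S w ≟ᵇ true) (ys⊆xs w∈ys) Sw)

memb≡true⇒∈ : ∀ {w xs} → memb w xs ≡ true → w ∈ xs
memb≡true⇒∈ {w} {xs} h =
  Any.map (≡ᵇ⇒≡ w _) (any⁻ (w ≡ᵇ_) xs (Equivalence.from T-≡ h))

∈⇒memb≡true : ∀ {w xs} → w ∈ xs → memb w xs ≡ true
∈⇒memb≡true {w} w∈xs = Equivalence.to T-≡ (any⁺ (w ≡ᵇ_) (Any.map (≡⇒≡ᵇ w _) w∈xs))

memb≡false⇒∉ : ∀ {w xs} → memb w xs ≡ false → w ∉ xs
memb≡false⇒∉ w∉ w∈ with trans (sym (∈⇒memb≡true w∈)) w∉
... | ()

endpoints-take⊆ : ∀ k (M : Matching) → endpoints (take k M) ⊆ endpoints M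
endpoints-take⊆ (suc k) (e ∷ M) (here eq)                = here eq
endpoints-take⊆ (suc k) (e ∷ M) (there (here eq))        = there (here eq)
endpoints-take⊆ (suc k) (e ∷ M) (there (there w∈take)) =
  there (there (endpoints-take⊆ k M w∈take))

length-endpoints : ∀ (M : Matching) → length (endpoints M) ≡ 2 * length M
length-endpoints []      = refl
length-endpoints (e ∷ M) = begin
  suc (suc (length (endpoints M))) ≡⟨ cong (suc ∘′ suc) (length-endpoints M) ⟩
  suc (suc (2 * length M))         ≡⟨ *-suc 2 (length M) ⟨
  2 * length (e ∷ M)               ∎
  where
  open ≡-Reasoning

EdgeCovered : VSet → ℕ × ℕ → Set
EdgeCovered S (u , v) = S u ≡ true ⊎ S v ≡ true

EdgeInside : VSet → ℕ × ℕ → Set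
EdgeInside S (u , v) = S u ≡ true × S v ≡ true

covered-edge-step : ∀ {a b : Bool} {c d} → a ≡ true ⊎ b ≡ true → c ≤ d → suc c ≤ χ a + (χ b + d)
covered-edge-step {b = b}     (inj₁ refl) c≤d = s≤s (≤-trans c≤d (m≤n+m _ (χ b)))
covered-edge-step {a = false} (inj₂ refl) c≤d = s≤s c≤d
covered-edge-step {a = true}  (inj₂ refl) c≤d = s≤s (m≤n⇒m≤1+n c≤d)

covered⇒length≤cnt : ∀ (S : VSet) (M : Matching) → All (EdgeCovered S) M →
                     length M ≤ cnt S (endpoints M)
covered⇒length≤cnt S []            []               = z≤n
covered⇒length≤cnt S ((u , v) ∷ M) (covered ∷ rest) =
  covered-edge-step covered (covered⇒length≤cnt S M rest)

covered⇒length<cnt : ∀ (S : VSet) (M : Matching) → All (EdgeCovered S) M →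
                     Any (EdgeInside S) M → length M < cnt S (endpoints M)
covered⇒length<cnt S ((u , v) ∷ M) (_ ∷ rest) (here (Su , Sv)) rewrite Su | Sv =
  s≤s (s≤s (covered⇒length≤cnt S M rest))
covered⇒length<cnt S ((u , v) ∷ M) (covered ∷ rest) (there inside) =
  covered-edge-step covered (covered⇒length<cnt S M rest inside)

EdgesIn : Graph → Matching → Set
EdgesIn G M = All (λ e → Arc G (proj₁ e) (proj₂ e)) M

cover⇒edges-covered : ∀ {G S M} → Cover G S → EdgesIn G M → All (EdgeCovered S) M
cover⇒edges-covered cover = All.map λ { {u , v} arc → cover u v arc }

module _ {G : Graph} {ns : List ℕ} {M M′ : Matching} where

  endpoints-grow : MatchUpd M ns (length G) M′ → endpoints M ⊆ endpoints M′
  endpoints-grow (addEdge _ _) = there ∘′ there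
  endpoints-grow (noEdge _)    = λ w∈ → w∈

  edgesIn-step : MatchUpd M ns (length G) M′ → EdgesIn G M → EdgesIn (ns ∷ G) M′
  edgesIn-step (addEdge p∈ns _) edges = here p∈ns ∷ All.map there edges
  edgesIn-step (noEdge _)       edges = All.map there edges

  module _ (ns-bounded : All (_< length G) ns)
           (bounded : All (_< length G) (endpoints M)) where

    bounded-step : MatchUpd M ns (length G) M′ → All (_< suc (length G)) (endpoints M′)
    bounded-step (addEdge p∈ns _) =
      m≤n⇒m≤1+n (All.lookup ns-bounded p∈ns) ∷ ≤-refl ∷ All.map m≤n⇒m≤1+n bounded
    bounded-step (noEdge _) = All.map m≤n⇒m≤1+n bounded

    unique-step : MatchUpd M ns (length G) M′ → Unique (endpoints M) → Unique (endpoints M′)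
    unique-step (noEdge _) unique = unique
    unique-step (addEdge {p} p∈ns p∉V_M) unique =
      (p≢v ∷ ¬Any⇒All¬ _ (memb≡false⇒∉ p∉V_M)) ∷ ¬Any⇒All¬ _ v∉endpoints ∷ unique
      where
      p≢v : ¬ p ≡ length G
      p≢v = <⇒≢ (All.lookup ns-bounded p∈ns)
      v∉endpoints : length G ∉ endpoints M
      v∉endpoints v∈ = <-irrefl refl (All.lookup bounded v∈)

lateAccept-true : ∀ M′ ns acc w → lateAccept M′ ns acc w ≡ true →
                  w ∈ endpoints M′ ⊎ acc w ≡ true
lateAccept-true M′ ns acc w accepted with inVM M′ w in w∈V_M
... | true  = inj₁ (memb≡true⇒∈ w∈V_M)
... | false = inj₂ accepted

record Invariant (G : Graph) (s : State) : Set where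
  field
    accepted⊆V_M      : ∀ {w} → accepted s w ≡ true → w ∈ endpoints (matching s)
    endpoints-unique  : Unique (endpoints (matching s))
    endpoints-bounded : All (_< length G) (endpoints (matching s))
    edges-in-graph    : EdgesIn G (matching s)
open Invariant

invariant-step : ∀ {G ns s s′} → Invariant G s → All (_< length G) ns → Step G ns s s′ →
                 Invariant (ns ∷ G) s′
invariant-step {G} {ns} {s} {s′} inv ns-bounded st = record
  { accepted⊆V_M      = accepted⊆V_M′
  ; endpoints-unique  = unique-step {G} ns-bounded (endpoints-bounded inv) matchUpd
                                    (endpoints-unique inv)
  ; endpoints-bounded = bounded-step {G} ns-bounded (endpoints-bounded inv) matchUpd
  ; edges-in-graph    = edgesIn-step {G} matchUpd (edges-in-graph inv)
  }
  where
  open Step st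
  accepted⊆V_M′ : ∀ {w} → accepted s′ w ≡ true → w ∈ endpoints (matching s′)
  accepted⊆V_M′ {w} accepted′ with memb w (top2 (matching s′)) in w∈top2
  ... | true  = endpoints-take⊆ 2 (matching s′) (memb≡true⇒∈ w∈top2)
  ... | false
    with lateAccept-true (matching s′) ns (accepted s) w
           (trans (sym (proj₂ admissible w w∈top2)) accepted′)
  ...   | inj₁ w∈V_M′ = w∈V_M′
  ...   | inj₂ accepted = endpoints-grow {G} matchUpd (accepted⊆V_M inv accepted)

invariant : ∀ {G s} → Reachable G s → Invariant G s
invariant start = record
  { accepted⊆V_M = λ () ; endpoints-unique = [] ; endpoints-bounded = [] ; edges-in-graph = [] }
invariant (step reachable ns-bounded st) = invariant-step (invariant reachable) ns-bounded st

accepted-size≤ : ∀ {G s} → Reachable G s → size G (accepted s) ≤ 2 * length (matching s)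
accepted-size≤ {G} {s} reachable = begin
  size G (accepted s)             ≤⟨ cnt≤length (accepted s) (Unique.upTo⁺ (length G))
                                       (λ _ → accepted⊆V_M (invariant reachable)) ⟩
  length (endpoints (matching s)) ≡⟨ length-endpoints (matching s) ⟩
  2 * length (matching s)         ∎
  where open ≤-Reasoning

module _ {G : Graph} {s : State} {opt : VSet}
         (reachable : Reachable G s) (cover : Cover G opt) where

  private
    inv = invariant reachable
    M   = matching s

    covered : All (EdgeCovered opt) M
    covered = cover⇒edges-covered cover (edges-in-graph inv)

    endpoints⊆vertices : endpoints M ⊆ upTo (length G)
    endpoints⊆vertices w∈ = ∈-upTo⁺ (All.lookup (endpoints-bounded inv) w∈)

  inside-edge⇒matching<cover : Any (EdgeInside opt) M → length M < size G opt
  inside-edge⇒matching<cover inside =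
    ≤-trans (covered⇒length<cnt opt M covered inside)
            (cnt-mono-⊆ opt (endpoints-unique inv) endpoints⊆vertices)

  outside-vertex⇒matching<cover : ∀ {v} → v < length G → opt v ≡ true → inVM M v ≡ false →
                                  length M < size G opt
  outside-vertex⇒matching<cover {v} v<n opt-v v∉V_M = begin-strict
    length M                   ≤⟨ covered⇒length≤cnt opt M covered ⟩
    cnt opt (endpoints M)      <⟨ n<1+n _ ⟩
    suc (cnt opt (endpoints M)) ≡⟨ cong (λ b → χ b + cnt opt (endpoints M)) opt-v ⟨
    cnt opt (v ∷ endpoints M)  ≤⟨ cnt-mono-⊆ opt
                                     (¬Any⇒All¬ _ (memb≡false⇒∉ v∉V_M) ∷ endpoints-unique inv)
                                     v∷endpoints⊆vertices ⟩
    size G opt                 ∎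
    where
    open ≤-Reasoning
    v∷endpoints⊆vertices : v ∷ endpoints M ⊆ upTo (length G)
    v∷endpoints⊆vertices (here refl) = ∈-upTo⁺ v<n
    v∷endpoints⊆vertices (there w∈) = endpoints⊆vertices w∈

mainTheorem11 : ∀ (G : Graph) (s : State) (opt : VSet) →
    Reachable G s → MinCover G opt →
    ((∃ λ v → v < length G × opt v ≡ true × inVM (matching s) v ≡ false)
      ⊎ Any (λ e → opt (proj₁ e) ≡ true × opt (proj₂ e) ≡ true) (matching s)) →
    size G (accepted s) + 2 ≤ 2 * size G opt
mainTheorem11 G s opt reachable (cover , _) extra = begin
  size G (accepted s) + 2 ≤⟨ +-monoˡ-≤ 2 (accepted-size≤ reachable) ⟩
  2 * m + 2               ≡⟨ +-comm (2 * m) 2 ⟩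
  2 + 2 * m               ≡⟨ *-suc 2 m ⟨
  2 * suc m               ≤⟨ *-monoʳ-≤ 2 matching<cover ⟩
  2 * size G opt          ∎
  where
  open ≤-Reasoning
  m = length (matching s)
  matching<cover : m < size G opt
  matching<cover =
    [ (λ (_ , v<n , opt-v , v∉V_M) →
          outside-vertex⇒matching<cover reachable cover v<n opt-v v∉V_M)
    , inside-edge⇒matching<cover reachable cover
    ]′ extra
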